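{- The product $F_R \cdot F_S = \sum_{T\in \mathrm{Sh}(R,S)} F_T$ (for $R\in\mathrm{IRel}_m$, $S\in\mathrm{IRel}_n$), extended bilinearly, defines an associative graded algebra structure on $\mathbb{K}\mathrm{IRel}$ (graded by size).
   Context: For $n \ge 0$ let $[n]=\{1,\dots,n\}$. An integer relation of size $n$ is a reflexive binary relation $R \subseteq [n]^2$; $\mathrm{IRel}_n$ denotes the set of these and $\mathrm{IRel}=\bigsqcup_{n\ge0}\mathrm{IRel}_n$. For $S\in\mathrm{IRel}_n$ and $m\ge 0$, let $\overline{S}=\{(m+i,m+j):(i,j)\in S\}$ and $\overline{[n]}=\{m+1,\dots,m+n\}$. For $R\in\mathrm{IRel}_m$, $S\in\mathrm{IRel}_n$, the shifted shuffle $\mathrm{Sh}(R,S)$ is the set of all relations $R\cup\overline{S}\cup I\cup D\in\mathrm{IRel}_{m+n}$ with $I\subseteq [m]\times\overline{[n]}$ and $D\subseteq \overline{[n]}\times[m]$. $\mathbb{K}$ is a field and $\mathbb{K}\mathrm{IRel}=\bigoplus_{n\ge0}\mathbb{K}\mathrm{IRel}_n$ is the vector space with basis $(F_R)_{R\in\mathrm{IRel}}$. -}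

module Defs where

open import Level using (Level; _⊔_; suc)
open import Algebra.Bundles using (CommutativeRing)
open import Data.Bool using (Bool; true; false; if_then_else_)
open import Data.Bool.Properties using () renaming (_≟_ to _≟ᵇ_)
open import Data.Nat using (ℕ; zero; _+_) renaming (suc to sucℕ; _≟_ to _≟ℕ_)
open import Data.Fin using (Fin; splitAt) renaming (zero to fzero; suc to fsuc)
open import Data.Fin.Properties using (all?)
open import Data.Sum using (_⊎_; inj₁; inj₂; [_,_]′)
open import Data.Product using (Σ; _×_; _,_; proj₁; proj₂)
open import Data.List using (List; []; _∷_; _++_; map; concatMap; foldr)
open import Relation.Nullary using (¬_; Dec; yes; no)
open import Relation.Binary.PropositionalEquality using (_≡_; refl)

record Field (c ℓ : Level) : Set (Level.suc (c ⊔ ℓ)) where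
  field
    commutativeRing : CommutativeRing c ℓ
  open CommutativeRing commutativeRing public
  field
    1≉0     : ¬ (1# ≈ 0#)
    inverse : ∀ x → ¬ (x ≈ 0#) → Σ Carrier (λ y → x * y ≈ 1#)

-- Integer relations.  A binary relation on [n] = Fin n is its
-- characteristic function; (i , j) ∈ R iff rel R i j ≡ true.

IRel : ℕ → Set
IRel n = Σ (Fin n → Fin n → Bool) (λ r → ∀ i → r i i ≡ true)

rel : ∀ {n} → IRel n → Fin n → Fin n → Bool
rel = proj₁

_≟R_ : ∀ {n} (R S : IRel n) → Dec (∀ i j → rel R i j ≡ rel S i j)
R ≟R S = all? (λ i → all? (λ j → rel R i j ≟ᵇ rel S i j))

IRel∅ : IRel 0
IRel∅ = (λ ()) , (λ ())

-- Fin (m + n) is split by splitAt m into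
-- inj₁ a  (the element a+1 ∈ [m])  and  inj₂ b  (the element m+b+1 ∈ [n]‾).
-- Given I ⊆ [m] × [n]‾ and D ⊆ [n]‾ × [m], the relation R ∪ S‾ ∪ I ∪ D:

glue : ∀ {m n} → (Fin m → Fin m → Bool) → (Fin n → Fin n → Bool)
     → (Fin m → Fin n → Bool) → (Fin n → Fin m → Bool)
     → Fin (m + n) → Fin (m + n) → Bool
glue {m} r s I D i j =
  [ (λ a → [ r a , I a ]′ (splitAt m j))
  , (λ b → [ D b , s b ]′ (splitAt m j)) ]′ (splitAt m i)

glue-refl : ∀ {m n} (R : IRel m) (S : IRel n) I D (i : Fin (m + n))
          → glue (rel R) (rel S) I D i i ≡ true
glue-refl {m} R S I D i with splitAt m i
... | inj₁ a = proj₂ R a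
... | inj₂ b = proj₂ S b

allFuns : ∀ {a} {A : Set a} (k : ℕ) → List A → List (Fin k → A)
allFuns zero    xs = (λ ()) ∷ []
allFuns (sucℕ k) xs =
  concatMap (λ x → map (λ f → λ { fzero → x ; (fsuc i) → f i }) (allFuns k xs)) xs

allBool : List Bool
allBool = false ∷ true ∷ []

allRels : (p q : ℕ) → List (Fin p → Fin q → Bool)
allRels p q = allFuns p (allFuns q allBool)

-- Sh(R,S), listed without repetition (distinct (I , D) give distinct relations)
Sh : ∀ {m n} → IRel m → IRel n → List (IRel (m + n))
Sh {m} {n} R S =
  concatMap (λ I → map (λ D → glue (rel R) (rel S) I D , glue-refl R S I D)
                       (allRels n m))
            (allRels m n)

-- An element is a formal (finite) linear combination of basis elements,
-- i.e. a list of terms c · F_R; two elements are equal iff all their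
-- coefficients agree.

module IRelAlgebra {c ℓ} (𝕂 : Field c ℓ) where
  open Field 𝕂 renaming (_+_ to _+𝕂_)

  Term : Set c
  Term = Σ ℕ (λ n → IRel n) × Carrier

  KIRel : Set c
  KIRel = List Term

  F : ∀ {n} → IRel n → KIRel
  F {n} R = ((n , R) , 1#) ∷ []

  zeroV : KIRel
  zeroV = []

  _⊕_ : KIRel → KIRel → KIRel
  _⊕_ = _++_

  _·_ : Carrier → KIRel → KIRel
  a · x = map (λ { (nR , b) → (nR , a * b) }) x

  coefTerm : ∀ {n} → IRel n → Term → Carrier
  coefTerm {n} S ((k , R) , b) with k ≟ℕ n
  ... | no  _    = 0#
  ... | yes refl with R ≟R S
  ...   | yes _ = b
  ...   | no  _ = 0#

  coef : KIRel → ∀ {n} → IRel n → Carrier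
  coef x S = foldr (λ t acc → coefTerm S t +𝕂 acc) 0# x

  _≋_ : KIRel → KIRel → Set ℓ
  x ≋ y = ∀ n (S : IRel n) → coef x S ≈ coef y S

  sumF : ∀ {n} → List (IRel n) → KIRel
  sumF L = concatMap F L

  mulTerm : Term → Term → KIRel
  mulTerm ((m , R) , a) ((n , S) , b) = (a * b) · sumF (Sh R S)

  _⋆_ : KIRel → KIRel → KIRel
  x ⋆ y = concatMap (λ t → concatMap (mulTerm t) y) x

  Homogeneous : ℕ → KIRel → Set ℓ
  Homogeneous d x = ∀ n (S : IRel n) → ¬ (n ≡ d) → coef x S ≈ 0#

  one : KIRel
  one = F IRel∅

  record IsAssocGradedAlgebra : Set (c ⊔ ℓ) where
    field
      ⋆-basis    : ∀ {m n} (R : IRel m) (S : IRel n) → (F R ⋆ F S) ≋ sumF (Sh R S)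
      ⋆-cong     : ∀ {x x' y y'} → x ≋ x' → y ≋ y' → (x ⋆ y) ≋ (x' ⋆ y')
      ⋆-distribʳ : ∀ x y z → ((x ⊕ y) ⋆ z) ≋ ((x ⋆ z) ⊕ (y ⋆ z))
      ⋆-distribˡ : ∀ x y z → (x ⋆ (y ⊕ z)) ≋ ((x ⋆ y) ⊕ (x ⋆ z))
      ⋆-scalarˡ  : ∀ a x y → ((a · x) ⋆ y) ≋ (a · (x ⋆ y))
      ⋆-scalarʳ  : ∀ a x y → (x ⋆ (a · y)) ≋ (a · (x ⋆ y))
      ⋆-assoc    : ∀ x y z → ((x ⋆ y) ⋆ z) ≋ (x ⋆ (y ⋆ z))
      ⋆-identityˡ : ∀ x → (one ⋆ x) ≋ x
      ⋆-identityʳ : ∀ x → (x ⋆ one) ≋ x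
      one-homogeneous : Homogeneous 0 one
      ⋆-graded   : ∀ m n x y → Homogeneous m x → Homogeneous n y
                 → Homogeneous (m + n) (x ⋆ y)

module Submission where

-- The product on 𝕂IRel is dual to deconcatenation.  Writing T[a,a+l) for
-- the restriction of a relation T ∈ IRel_k to the window {a+1,…,a+l},
-- standardised to a relation in IRel_l, the central identity is
--
--   coef (x ⋆ y) T  ≈  Σ_{p ≤ k} coef x (T[0,p)) · coef y (T[p,k)).      (∗)
--
-- For basis elements this is the statement that T ∈ Sh(R,S) iff T restricts
-- to R on [m] and to S on the shifted copy of [n]: each such T arises from
-- exactly one pair (I , D), namely the off-diagonal blocks of T.

open import Defs
open import Level using (Level)
open import Algebra.Bundles using (CommutativeRing)
open import Data.Bool using (Bool; true; false)
open import Data.Bool.Properties using () renaming (_≟_ to _≟ᵇ_)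
open import Data.Empty using (⊥-elim)
open import Data.Fin using (Fin; toℕ; fromℕ<; _↑ˡ_; _↑ʳ_; splitAt)
  renaming (zero to fzero; suc to fsuc)
open import Data.Fin.Properties
  using (all?; toℕ-fromℕ<; fromℕ<-toℕ; fromℕ<-cong; toℕ<n; toℕ-↑ˡ; toℕ-↑ʳ;
         splitAt-↑ˡ; splitAt-↑ʳ; splitAt⁻¹-↑ˡ; splitAt⁻¹-↑ʳ)
open import Data.List using (List; []; _∷_; _++_; map; concatMap; foldr)
open import Data.Nat using (ℕ; zero; suc; _+_; _∸_; _<_; _≤_; s≤s; z≤n; s≤s⁻¹)
  renaming (_≟_ to _≟ℕ_)
import Data.Nat.Properties as ℕₚ
open ℕₚ
  using (_<?_; <⇒≢; m≤n⇒m<n∨m≡n; m<n⇒m<1+n; n<1+n; n∸n≡0; m∸n≤m; m≤m+n;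
         +-∸-assoc; ∸-+-assoc; m+n∸m≡n; m+[n∸m]≡n; m∸[m∸n]≡n;
         +-monoʳ-<; <-≤-trans; ≤-reflexive)
open import Data.Product using (_×_; _,_; proj₂)
open import Data.Sum using (inj₁; inj₂)
open import Relation.Nullary using (¬_; Dec; yes; no)
open import Relation.Nullary.Decidable using (_×-dec_)
open import Relation.Binary.PropositionalEquality
  using (_≡_; _≢_; refl; sym; trans; cong; cong₂; subst)

module FiniteSums {c ℓ} (R : CommutativeRing c ℓ) where
  open CommutativeRing R
    renaming (_+_ to _+ᴿ_; refl to ≈-refl; sym to ≈-sym; trans to ≈-trans)
  open import Relation.Binary.Reasoning.Setoid setoid
  open import Algebra.Properties.CommutativeSemigroup +-commutativeSemigroup
    using (interchange)

  sumL : ∀ {a} {A : Set a} → List A → (A → Carrier) → Carrier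
  sumL xs f = foldr (λ x acc → f x +ᴿ acc) 0# xs

  sumN : ℕ → (ℕ → Carrier) → Carrier
  sumN zero    f = 0#
  sumN (suc N) f = sumN N f +ᴿ f N

  module _ {a} {A : Set a} where

    sumL-cong : ∀ (xs : List A) {f g} → (∀ x → f x ≈ g x) → sumL xs f ≈ sumL xs g
    sumL-cong []       f≈g = ≈-refl
    sumL-cong (x ∷ xs) f≈g = +-cong (f≈g x) (sumL-cong xs f≈g)

    sumL-++ : ∀ (xs ys : List A) f → sumL (xs ++ ys) f ≈ sumL xs f +ᴿ sumL ys f
    sumL-++ []       ys f = ≈-sym (+-identityˡ _)
    sumL-++ (x ∷ xs) ys f = ≈-trans (+-congˡ (sumL-++ xs ys f)) (≈-sym (+-assoc _ _ _))

    sumL-*ˡ : ∀ (xs : List A) a f → a * sumL xs f ≈ sumL xs (λ x → a * f x)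
    sumL-*ˡ []       a f = zeroʳ a
    sumL-*ˡ (x ∷ xs) a f = ≈-trans (distribˡ _ _ _) (+-congˡ (sumL-*ˡ xs a f))

    sumL-*ʳ : ∀ (xs : List A) a f → sumL xs f * a ≈ sumL xs (λ x → f x * a)
    sumL-*ʳ []       a f = zeroˡ a
    sumL-*ʳ (x ∷ xs) a f = ≈-trans (distribʳ _ _ _) (+-congˡ (sumL-*ʳ xs a f))

    sumL-0 : ∀ (xs : List A) f → (∀ x → f x ≈ 0#) → sumL xs f ≈ 0#
    sumL-0 []       f f≈0 = ≈-refl
    sumL-0 (x ∷ xs) f f≈0 = ≈-trans (+-cong (f≈0 x) (sumL-0 xs f f≈0)) (+-identityˡ _)

  sumL-concatMap : ∀ {a b} {A : Set a} {B : Set b} (g : A → List B) (xs : List A) f →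
                   sumL (concatMap g xs) f ≈ sumL xs (λ x → sumL (g x) f)
  sumL-concatMap g []       f = ≈-refl
  sumL-concatMap g (x ∷ xs) f =
    ≈-trans (sumL-++ (g x) (concatMap g xs) f) (+-congˡ (sumL-concatMap g xs f))

  sumL-map : ∀ {a b} {A : Set a} {B : Set b} (g : A → B) (xs : List A) f →
             sumL (map g xs) f ≈ sumL xs (λ x → f (g x))
  sumL-map g []       f = ≈-refl
  sumL-map g (x ∷ xs) f = +-congˡ (sumL-map g xs f)

  sumL-factorise : ∀ {a b} {A : Set a} {B : Set b} (xs : List A) (ys : List B) f g →
                   sumL xs (λ x → sumL ys (λ y → f x * g y)) ≈ sumL xs f * sumL ys g
  sumL-factorise xs ys f g = begin
      sumL xs (λ x → sumL ys (λ y → f x * g y))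
    ≈⟨ sumL-cong xs (λ x → ≈-sym (sumL-*ˡ ys (f x) g)) ⟩
      sumL xs (λ x → f x * sumL ys g)
    ≈⟨ ≈-sym (sumL-*ʳ xs (sumL ys g) f) ⟩
      sumL xs f * sumL ys g
    ∎

  sumN-cong : ∀ N {f g} → (∀ p → p < N → f p ≈ g p) → sumN N f ≈ sumN N g
  sumN-cong zero    f≈g = ≈-refl
  sumN-cong (suc N) f≈g =
    +-cong (sumN-cong N (λ p p<N → f≈g p (m<n⇒m<1+n p<N))) (f≈g N (n<1+n N))

  sumN-+ : ∀ N f g → sumN N (λ p → f p +ᴿ g p) ≈ sumN N f +ᴿ sumN N g
  sumN-+ zero    f g = ≈-sym (+-identityˡ _)
  sumN-+ (suc N) f g = ≈-trans (+-congʳ (sumN-+ N f g)) (interchange _ _ _ _)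

  sumN-*ˡ : ∀ N a f → a * sumN N f ≈ sumN N (λ p → a * f p)
  sumN-*ˡ zero    a f = zeroʳ a
  sumN-*ˡ (suc N) a f = ≈-trans (distribˡ _ _ _) (+-congʳ (sumN-*ˡ N a f))

  sumN-*ʳ : ∀ N a f → sumN N f * a ≈ sumN N (λ p → f p * a)
  sumN-*ʳ zero    a f = zeroˡ a
  sumN-*ʳ (suc N) a f = ≈-trans (distribʳ _ _ _) (+-congʳ (sumN-*ʳ N a f))

  sumN-0 : ∀ N f → (∀ p → p < N → f p ≈ 0#) → sumN N f ≈ 0#
  sumN-0 zero    f f≈0 = ≈-refl
  sumN-0 (suc N) f f≈0 =
    ≈-trans (+-cong (sumN-0 N f (λ p p<N → f≈0 p (m<n⇒m<1+n p<N))) (f≈0 N (n<1+n N)))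
            (+-identityˡ _)

  sumN-single : ∀ N m f → m < N → (∀ p → p < N → p ≢ m → f p ≈ 0#) → sumN N f ≈ f m
  sumN-single (suc N) m f (s≤s m≤N) f≈0 with m≤n⇒m<n∨m≡n m≤N
  ... | inj₂ refl =
    ≈-trans (+-congʳ (sumN-0 N f (λ p p<N → f≈0 p (m<n⇒m<1+n p<N) (<⇒≢ p<N))))
            (+-identityˡ _)
  ... | inj₁ m<N =
    ≈-trans (+-cong (sumN-single N m f m<N (λ p p<N → f≈0 p (m<n⇒m<1+n p<N)))
                    (f≈0 N (n<1+n N) (λ N≡m → <⇒≢ m<N (sym N≡m))))
            (+-identityʳ _)

  sumL-sumN : ∀ {a} {A : Set a} (xs : List A) N (h : A → ℕ → Carrier) →
              sumL xs (λ x → sumN N (h x)) ≈ sumN N (λ p → sumL xs (λ x → h x p))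
  sumL-sumN []       N h = ≈-sym (sumN-0 N _ (λ _ _ → ≈-refl))
  sumL-sumN (x ∷ xs) N h = ≈-trans (+-congˡ (sumL-sumN xs N h)) (≈-sym (sumN-+ N _ _))

  sumN-triangle : ∀ N (g : ℕ → ℕ → Carrier) →
                  sumN N (λ m → sumN (suc m) (λ p → g p m))
                    ≈ sumN N (λ p → sumN (N ∸ p) (λ q → g p (p + q)))
  sumN-triangle zero    g = ≈-refl
  sumN-triangle (suc N) g = begin
      sumN N (λ m → sumN (suc m) (λ p → g p m)) +ᴿ sumN (suc N) (λ p → g p N)
    ≈⟨ +-congʳ (≈-trans (sumN-triangle N g) (≈-trans (≈-sym (+-identityʳ _)) (+-congˡ (≈-sym empty-row)))) ⟩
      sumN (suc N) (λ p → sumN (N ∸ p) (λ q → g p (p + q))) +ᴿ sumN (suc N) (λ p → g p N)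
    ≈⟨ ≈-sym (sumN-+ (suc N) _ _) ⟩
      sumN (suc N) (λ p → sumN (N ∸ p) (λ q → g p (p + q)) +ᴿ g p N)
    ≈⟨ sumN-cong (suc N) extend ⟩
      sumN (suc N) (λ p → sumN (suc N ∸ p) (λ q → g p (p + q)))
    ∎
    where
    empty-row : sumN (N ∸ N) (λ q → g N (N + q)) ≈ 0#
    empty-row rewrite n∸n≡0 N = ≈-refl

    -- the new diagonal term g p N is the term q = N ∸ p of row p
    extend : ∀ p → p < suc N →
             sumN (N ∸ p) (λ q → g p (p + q)) +ᴿ g p N ≈ sumN (suc N ∸ p) (λ q → g p (p + q))
    extend p (s≤s p≤N) rewrite +-∸-assoc 1 p≤N =
      +-congˡ (reflexive (cong (g p) (sym (m+[n∸m]≡n p≤N))))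

-- Windows.  entry T i j reads T at natural-number coordinates (and is
-- `true` outside [0,k)); window T a l is the standardised restriction of T
-- to positions a, …, a+l-1.  Being total, windows can be taken at every
-- position of a sum without carrying bounds.

entry : ∀ {k} → IRel k → ℕ → ℕ → Bool
entry {k} T i j with i <? k | j <? k
... | yes i<k | yes j<k = rel T (fromℕ< i<k) (fromℕ< j<k)
... | _       | _       = true

entry-refl : ∀ {k} (T : IRel k) i → entry T i i ≡ true
entry-refl {k} T i with i <? k
... | yes i<k = proj₂ T (fromℕ< i<k)
... | no  _   = refl

entry-inside : ∀ {k} (T : IRel k) i j (i<k : i < k) (j<k : j < k) →
               entry T i j ≡ rel T (fromℕ< i<k) (fromℕ< j<k)
entry-inside {k} T i j i<k j<k with i <? k | j <? k
... | yes i<k′ | yes j<k′ = cong₂ (rel T) (fromℕ<-cong i i refl i<k′ i<k)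
                                          (fromℕ<-cong j j refl j<k′ j<k)
... | yes _    | no  j≮k  = ⊥-elim (j≮k j<k)
... | no  i≮k  | _        = ⊥-elim (i≮k i<k)

entry-toℕ : ∀ {k} (T : IRel k) (i j : Fin k) → entry T (toℕ i) (toℕ j) ≡ rel T i j
entry-toℕ T i j = trans (entry-inside T (toℕ i) (toℕ j) (toℕ<n i) (toℕ<n j))
                        (cong₂ (rel T) (fromℕ<-toℕ i (toℕ<n i)) (fromℕ<-toℕ j (toℕ<n j)))

window : ∀ {k} → IRel k → ℕ → (l : ℕ) → IRel l
window T a l = (λ i j → entry T (a + toℕ i) (a + toℕ j)) , (λ i → entry-refl T (a + toℕ i))

_≐_ : ∀ {k} → IRel k → IRel k → Set
R ≐ S = ∀ i j → rel R i j ≡ rel S i j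

entry-window : ∀ {k} (T : IRel k) a l i j → i < l → j < l →
               entry (window T a l) i j ≡ entry T (a + i) (a + j)
entry-window T a l i j i<l j<l =
  trans (entry-inside (window T a l) i j i<l j<l)
        (cong₂ (λ i′ j′ → entry T (a + i′) (a + j′)) (toℕ-fromℕ< i<l) (toℕ-fromℕ< j<l))

window-window : ∀ {k} (T : IRel k) a l b l′ → b + l′ ≤ l →
                window (window T a l) b l′ ≐ window T (a + b) l′
window-window T a l b l′ b+l′≤l i j =
  trans (entry-window T a l (b + toℕ i) (b + toℕ j) (inside i) (inside j))
        (cong₂ (entry T) (sym (ℕₚ.+-assoc a b (toℕ i))) (sym (ℕₚ.+-assoc a b (toℕ j))))
  where
  inside : ∀ (i : Fin l′) → b + toℕ i < l
  inside i = <-≤-trans (+-monoʳ-< b (toℕ<n i)) b+l′≤l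

window-all : ∀ {k} (T : IRel k) → window T 0 k ≐ T
window-all T = entry-toℕ T

window-left : ∀ {m n} (T : IRel (m + n)) (a a′ : Fin m) →
              rel (window T 0 m) a a′ ≡ rel T (a ↑ˡ n) (a′ ↑ˡ n)
window-left {m} {n} T a a′ =
  trans (cong₂ (entry T) (sym (toℕ-↑ˡ a n)) (sym (toℕ-↑ˡ a′ n))) (entry-toℕ T (a ↑ˡ n) (a′ ↑ˡ n))

window-right : ∀ {m n} (T : IRel (m + n)) (b b′ : Fin n) →
               rel (window T m n) b b′ ≡ rel T (m ↑ʳ b) (m ↑ʳ b′)
window-right {m} {n} T b b′ =
  trans (cong₂ (entry T) (sym (toℕ-↑ʳ m b)) (sym (toℕ-↑ʳ m b′))) (entry-toℕ T (m ↑ʳ b) (m ↑ʳ b′))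

split-ind : ∀ {m n} (Q : Fin (m + n) → Set) →
            (∀ a → Q (a ↑ˡ n)) → (∀ b → Q (m ↑ʳ b)) → ∀ i → Q i
split-ind {m} {n} Q left right i with splitAt m i in eq
... | inj₁ a = subst Q (splitAt⁻¹-↑ˡ eq) (left a)
... | inj₂ b = subst Q (splitAt⁻¹-↑ʳ eq) (right b)

upperBlock : ∀ {m n} → IRel (m + n) → Fin m → Fin n → Bool
upperBlock {m} {n} T a b = rel T (a ↑ˡ n) (m ↑ʳ b)

lowerBlock : ∀ {m n} → IRel (m + n) → Fin n → Fin m → Bool
lowerBlock {m} {n} T b a = rel T (m ↑ʳ b) (a ↑ˡ n)

glued : ∀ {m n} → IRel m → IRel n → (Fin m → Fin n → Bool) → (Fin n → Fin m → Bool) →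
        IRel (m + n)
glued R S I D = glue (rel R) (rel S) I D , glue-refl R S I D

HasBlocks : ∀ {m n} → IRel m → IRel n → (Fin m → Fin n → Bool) → (Fin n → Fin m → Bool) →
            IRel (m + n) → Set
HasBlocks {m} {n} R S I D T =
  (R ≐ window T 0 m × S ≐ window T m n) ×
  ((∀ a b → I a b ≡ upperBlock T a b) × (∀ b a → D b a ≡ lowerBlock T b a))

module _ {m n} (R : IRel m) (S : IRel n) (I : Fin m → Fin n → Bool) (D : Fin n → Fin m → Bool) where
  private
    G : Fin (m + n) → Fin (m + n) → Bool
    G = rel (glued R S I D)

  glue-ll : ∀ a a′ → G (a ↑ˡ n) (a′ ↑ˡ n) ≡ rel R a a′
  glue-ll a a′ rewrite splitAt-↑ˡ m a n | splitAt-↑ˡ m a′ n = refl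

  glue-lr : ∀ a b → G (a ↑ˡ n) (m ↑ʳ b) ≡ I a b
  glue-lr a b rewrite splitAt-↑ˡ m a n | splitAt-↑ʳ m n b = refl

  glue-rl : ∀ b a → G (m ↑ʳ b) (a ↑ˡ n) ≡ D b a
  glue-rl b a rewrite splitAt-↑ʳ m n b | splitAt-↑ˡ m a n = refl

  glue-rr : ∀ b b′ → G (m ↑ʳ b) (m ↑ʳ b′) ≡ rel S b b′
  glue-rr b b′ rewrite splitAt-↑ʳ m n b | splitAt-↑ʳ m n b′ = refl

  glued⇒blocks : ∀ T → glued R S I D ≐ T → HasBlocks R S I D T
  glued⇒blocks T G≐T =
    ( (λ a a′ → trans (sym (glue-ll a a′)) (trans (G≐T _ _) (sym (window-left T a a′))))
    , (λ b b′ → trans (sym (glue-rr b b′)) (trans (G≐T _ _) (sym (window-right T b b′)))) )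
    , ( (λ a b → trans (sym (glue-lr a b)) (G≐T _ _))
      , (λ b a → trans (sym (glue-rl b a)) (G≐T _ _)) )

  blocks⇒glued : ∀ T → HasBlocks R S I D T → glued R S I D ≐ T
  blocks⇒glued T ((R≐ , S≐) , (I≡ , D≡)) =
    split-ind (λ i → ∀ j → G i j ≡ rel T i j)
      (λ a → split-ind (λ j → G (a ↑ˡ n) j ≡ rel T (a ↑ˡ n) j)
         (λ a′ → trans (glue-ll a a′) (trans (R≐ a a′) (window-left T a a′)))
         (λ b → trans (glue-lr a b) (I≡ a b)))
      (λ b → split-ind (λ j → G (m ↑ʳ b) j ≡ rel T (m ↑ʳ b) j)
         (λ a → trans (glue-rl b a) (D≡ b a))
         (λ b′ → trans (glue-rr b b′) (trans (S≐ b b′) (window-right T b b′))))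

module Indicators {c ℓ} (R : CommutativeRing c ℓ) where
  open CommutativeRing R
    renaming (_+_ to _+ᴿ_; refl to ≈-refl; sym to ≈-sym; trans to ≈-trans)
  open FiniteSums R
  open import Relation.Binary.Reasoning.Setoid setoid

  ind : ∀ {p} {P : Set p} → Dec P → Carrier
  ind (yes _) = 1#
  ind (no  _) = 0#

  ind-yes : ∀ {p} {P : Set p} (P? : Dec P) → P → ind P? ≈ 1#
  ind-yes (yes _) _  = ≈-refl
  ind-yes (no ¬p) p  = ⊥-elim (¬p p)

  ind-no : ∀ {p} {P : Set p} (P? : Dec P) → ¬ P → ind P? ≈ 0#
  ind-no (yes p) ¬p = ⊥-elim (¬p p)
  ind-no (no _)  _  = ≈-refl

  ind-iff : ∀ {p q} {P : Set p} {Q : Set q} (P? : Dec P) (Q? : Dec Q) →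
            (P → Q) → (Q → P) → ind P? ≈ ind Q?
  ind-iff (yes p) Q? to from = ≈-sym (ind-yes Q? (to p))
  ind-iff (no ¬p) Q? to from = ≈-sym (ind-no Q? (λ q → ¬p (from q)))

  ind-× : ∀ {p q} {P : Set p} {Q : Set q} (P? : Dec P) (Q? : Dec Q) →
          ind (P? ×-dec Q?) ≈ ind P? * ind Q?
  ind-× (yes _) (yes _) = ≈-sym (*-identityˡ 1#)
  ind-× (yes _) (no _)  = ≈-sym (zeroʳ 1#)
  ind-× (no _)  Q?      = ≈-sym (zeroˡ (ind Q?))

  ind-all-suc : ∀ {p} k {P : Fin (suc k) → Set p} (P? : ∀ i → Dec (P i)) →
                ind (all? P?) ≈ ind (P? fzero) * ind (all? (λ i → P? (fsuc i)))
  ind-all-suc k P? = ≈-trans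
    (ind-iff (all? P?) (P? fzero ×-dec all? (λ i → P? (fsuc i)))
       (λ all-P → all-P fzero , λ i → all-P (fsuc i))
       (λ { (P0 , _) fzero → P0 ; (_ , Psuc) (fsuc i) → Psuc i }))
    (ind-× (P? fzero) (all? (λ i → P? (fsuc i))))

  count-allFuns : ∀ {a r} {A : Set a} (xs : List A) {_~_ : A → A → Set r}
                  (_~?_ : ∀ x y → Dec (x ~ y)) → (∀ y → sumL xs (λ x → ind (x ~? y)) ≈ 1#) →
                  ∀ k (g : Fin k → A) → sumL (allFuns k xs) (λ f → ind (all? (λ i → f i ~? g i))) ≈ 1#
  count-allFuns xs _~?_ unique zero g = +-identityʳ 1#
  count-allFuns {A = A} xs _~?_ unique (suc k) g = begin
      sumL (allFuns (suc k) xs) agree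
    ≈⟨ sumL-concatMap _ xs agree ⟩
      _
    ≈⟨ sumL-cong xs (λ x → sumL-map _ (allFuns k xs) agree) ⟩
      _
    ≈⟨ sumL-cong xs (λ x → sumL-cong (allFuns k xs) (λ f → ind-all-suc k (λ i → _ ~? g i))) ⟩
      sumL xs (λ x → sumL (allFuns k xs) (λ f → ind (x ~? g fzero) * agreeTail f))
    ≈⟨ sumL-factorise xs (allFuns k xs) (λ x → ind (x ~? g fzero)) agreeTail ⟩
      sumL xs (λ x → ind (x ~? g fzero)) * sumL (allFuns k xs) agreeTail
    ≈⟨ *-cong (unique (g fzero)) (count-allFuns xs _~?_ unique k (λ i → g (fsuc i))) ⟩
      1# * 1#
    ≈⟨ *-identityˡ 1# ⟩
      1#
    ∎
    where
    agree : (Fin (suc k) → A) → Carrier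
    agree f = ind (all? (λ i → f i ~? g i))
    agreeTail : (Fin k → A) → Carrier
    agreeTail f = ind (all? (λ i → f i ~? g (fsuc i)))

  count-bool : ∀ b → sumL allBool (λ x → ind (x ≟ᵇ b)) ≈ 1#
  count-bool false = ≈-trans (+-congˡ (+-identityʳ _)) (+-identityʳ _)
  count-bool true  = ≈-trans (+-congˡ (+-identityʳ _)) (+-identityˡ _)

  count-allRels : ∀ p q (G : Fin p → Fin q → Bool) →
                  sumL (allRels p q) (λ I → ind (all? (λ a → all? (λ b → I a b ≟ᵇ G a b)))) ≈ 1#
  count-allRels p q G =
    count-allFuns (allFuns q allBool) (λ f g → all? (λ b → f b ≟ᵇ g b))
                  (count-allFuns allBool _≟ᵇ_ count-bool q) p G

-- Convolution of coefficient functions: the right-hand side of (∗).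
-- These are the algebra laws of (∗) in a form independent of the
-- representation of 𝕂IRel; they rest only on sums and windows.

module Convolution {c ℓ} (R : CommutativeRing c ℓ) where
  open CommutativeRing R
    renaming (_+_ to _+ᴿ_; refl to ≈-refl; sym to ≈-sym; trans to ≈-trans)
  open FiniteSums R
  open import Relation.Binary.Reasoning.Setoid setoid
  open import Algebra.Properties.CommutativeSemigroup *-commutativeSemigroup
    using (x∙yz≈y∙xz)

  Coefs : Set c
  Coefs = ∀ {l} → IRel l → Carrier

  Extensional : Coefs → Set ℓ
  Extensional φ = ∀ {l} (A B : IRel l) → A ≐ B → φ A ≈ φ B

  Concentrated : ℕ → Coefs → Set ℓ
  Concentrated d φ = ∀ n (A : IRel n) → ¬ (n ≡ d) → φ A ≈ 0#

  conv : Coefs → Coefs → Coefs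
  conv φ ψ {k} T = sumN (suc k) (λ p → φ (window T 0 p) * ψ (window T p (k ∸ p)))

  module _ {k} (T : IRel k) where

    conv-cong : ∀ {φ φ′ ψ ψ′ : Coefs} → (∀ {l} (A : IRel l) → φ A ≈ φ′ A) →
                (∀ {l} (A : IRel l) → ψ A ≈ ψ′ A) → conv φ ψ T ≈ conv φ′ ψ′ T
    conv-cong φ≈ ψ≈ = sumN-cong (suc k) (λ p _ → *-cong (φ≈ _) (ψ≈ _))

    conv-congˡ : ∀ {φ φ′ : Coefs} (ψ : Coefs) → (∀ {l} (A : IRel l) → φ A ≈ φ′ A) →
                 conv φ ψ T ≈ conv φ′ ψ T
    conv-congˡ ψ φ≈ = sumN-cong (suc k) (λ p _ → *-congʳ (φ≈ _))

    conv-congʳ : ∀ (φ : Coefs) {ψ ψ′ : Coefs} → (∀ {l} (A : IRel l) → ψ A ≈ ψ′ A) →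
                 conv φ ψ T ≈ conv φ ψ′ T
    conv-congʳ φ ψ≈ = sumN-cong (suc k) (λ p _ → *-congˡ (ψ≈ _))

    conv-+ˡ : ∀ (φ₁ φ₂ ψ : Coefs) →
              conv (λ A → φ₁ A +ᴿ φ₂ A) ψ T ≈ conv φ₁ ψ T +ᴿ conv φ₂ ψ T
    conv-+ˡ φ₁ φ₂ ψ = ≈-trans (sumN-cong (suc k) (λ p _ → distribʳ _ _ _)) (sumN-+ (suc k) _ _)

    conv-+ʳ : ∀ (φ ψ₁ ψ₂ : Coefs) →
              conv φ (λ A → ψ₁ A +ᴿ ψ₂ A) T ≈ conv φ ψ₁ T +ᴿ conv φ ψ₂ T
    conv-+ʳ φ ψ₁ ψ₂ = ≈-trans (sumN-cong (suc k) (λ p _ → distribˡ _ _ _)) (sumN-+ (suc k) _ _)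

    conv-*ˡ : ∀ a (φ ψ : Coefs) → conv (λ A → a * φ A) ψ T ≈ a * conv φ ψ T
    conv-*ˡ a φ ψ = ≈-trans (sumN-cong (suc k) (λ p _ → *-assoc _ _ _)) (≈-sym (sumN-*ˡ (suc k) a _))

    conv-*ʳ : ∀ a (φ ψ : Coefs) → conv φ (λ A → a * ψ A) T ≈ a * conv φ ψ T
    conv-*ʳ a φ ψ = ≈-trans (sumN-cong (suc k) (λ p _ → x∙yz≈y∙xz _ _ _)) (≈-sym (sumN-*ˡ (suc k) a _))

    conv-sumLˡ : ∀ {a} {X : Set a} (xs : List X) (φ : X → Coefs) (ψ : Coefs) →
                 sumL xs (λ x → conv (φ x) ψ T) ≈ conv (λ A → sumL xs (λ x → φ x A)) ψ T
    conv-sumLˡ xs φ ψ = ≈-trans (sumL-sumN xs (suc k) _)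
                                (sumN-cong (suc k) (λ p _ → ≈-sym (sumL-*ʳ xs _ _)))

    conv-sumLʳ : ∀ {a} {X : Set a} (xs : List X) (φ : Coefs) (ψ : X → Coefs) →
                 sumL xs (λ x → conv φ (ψ x) T) ≈ conv φ (λ A → sumL xs (λ x → ψ x A)) T
    conv-sumLʳ xs φ ψ = ≈-trans (sumL-sumN xs (suc k) _)
                                (sumN-cong (suc k) (λ p _ → ≈-sym (sumL-*ˡ xs _ _)))

    conv-concentratedˡ : ∀ {m} (φ ψ : Coefs) → Concentrated m φ → m ≤ k →
                         conv φ ψ T ≈ φ (window T 0 m) * ψ (window T m (k ∸ m))
    conv-concentratedˡ {m} φ ψ φ-conc m≤k =
      sumN-single (suc k) m _ (s≤s m≤k)
        (λ p _ p≢m → ≈-trans (*-congʳ (φ-conc p (window T 0 p) p≢m)) (zeroˡ _))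

    conv-concentratedʳ : ∀ {n} (φ ψ : Coefs) → Concentrated n ψ → n ≤ k →
                         conv φ ψ T ≈ φ (window T 0 (k ∸ n)) * ψ (window T (k ∸ n) n)
    conv-concentratedʳ {n} φ ψ ψ-conc n≤k = ≈-trans
      (sumN-single (suc k) (k ∸ n) _ (s≤s (m∸n≤m k n))
        (λ p p<1+k p≢ → ≈-trans (*-congˡ (ψ-conc (k ∸ p) _ (λ e → p≢ (split-position p<1+k e))))
                              (zeroʳ _)))
      (*-congˡ (reflexive (cong (λ l → ψ (window T (k ∸ n) l)) (m∸[m∸n]≡n n≤k))))
      where
      split-position : ∀ {p} → p < suc k → k ∸ p ≡ n → p ≡ k ∸ n
      split-position (s≤s p≤k) k∸p≡n = trans (sym (m∸[m∸n]≡n p≤k)) (cong (k ∸_) k∸p≡n)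

  conv-concentrated : ∀ {m n} (φ ψ : Coefs) → Concentrated m φ → Concentrated n ψ →
                      Concentrated (m + n) (conv φ ψ)
  conv-concentrated {m} {n} φ ψ φ-conc ψ-conc k T k≢m+n =
    sumN-0 (suc k) _ (λ p p≤k → vanishes p p≤k (p ≟ℕ m))
    where
    vanishes : ∀ p → p < suc k → Dec (p ≡ m) → φ (window T 0 p) * ψ (window T p (k ∸ p)) ≈ 0#
    vanishes p _ (no p≢m) = ≈-trans (*-congʳ (φ-conc p _ p≢m)) (zeroˡ _)
    vanishes p (s≤s p≤k) (yes refl) = ≈-trans (*-congˡ (ψ-conc (k ∸ p) _ k∸p≢n)) (zeroʳ _)
      where
      k∸p≢n : k ∸ p ≢ n
      k∸p≢n e = k≢m+n (trans (sym (m+[n∸m]≡n p≤k)) (cong (p +_) e))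

  module _ (ε : Coefs) (ε-conc : Concentrated 0 ε) (ε-empty : ∀ (A : IRel 0) → ε A ≈ 1#)
           (φ : Coefs) (φ-ext : Extensional φ) {k} (T : IRel k) where

    conv-identityˡ : conv ε φ T ≈ φ T
    conv-identityˡ = begin
        conv ε φ T
      ≈⟨ conv-concentratedˡ T ε φ ε-conc z≤n ⟩
        ε (window T 0 0) * φ (window T 0 k)
      ≈⟨ ≈-trans (*-congʳ (ε-empty _)) (*-identityˡ _) ⟩
        φ (window T 0 k)
      ≈⟨ φ-ext _ _ (window-all T) ⟩
        φ T
      ∎

    conv-identityʳ : conv φ ε T ≈ φ T
    conv-identityʳ = begin
        conv φ ε T
      ≈⟨ conv-concentratedʳ T φ ε ε-conc z≤n ⟩
        φ (window T 0 k) * ε (window T k 0)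
      ≈⟨ ≈-trans (*-congˡ (ε-empty _)) (*-identityʳ _) ⟩
        φ (window T 0 k)
      ≈⟨ φ-ext _ _ (window-all T) ⟩
        φ T
      ∎

  -- Associativity: both sides sum over the ways of cutting T into three
  -- consecutive windows of sizes p, q and k - p - q.
  conv-assoc : ∀ (φ ψ χ : Coefs) → Extensional φ → Extensional ψ → Extensional χ →
               ∀ {k} (T : IRel k) → conv (conv φ ψ) χ T ≈ conv φ (conv ψ χ) T
  conv-assoc φ ψ χ φ-ext ψ-ext χ-ext {k} T = begin
      conv (conv φ ψ) χ T
    ≈⟨ sumN-cong (suc k) (λ m _ → cut-left m) ⟩
      sumN (suc k) (λ m → sumN (suc m) (λ p → cut p m))
    ≈⟨ sumN-triangle (suc k) cut ⟩
      sumN (suc k) (λ p → sumN (suc k ∸ p) (λ q → cut p (p + q)))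
    ≈⟨ sumN-cong (suc k) (λ p p<1+k → cut-right p (s≤s⁻¹ p<1+k)) ⟩
      conv φ (conv ψ χ) T
    ∎
    where
    cut : ℕ → ℕ → Carrier
    cut p m = (φ (window T 0 p) * ψ (window T p (m ∸ p))) * χ (window T m (k ∸ m))

    cut-left : ∀ m → conv φ ψ (window T 0 m) * χ (window T m (k ∸ m)) ≈ sumN (suc m) (λ p → cut p m)
    cut-left m = ≈-trans (sumN-*ʳ (suc m) _ _) (sumN-cong (suc m) (λ p p<1+m → *-congʳ (*-cong
      (φ-ext _ _ (window-window T 0 m 0 p (s≤s⁻¹ p<1+m)))
      (ψ-ext _ _ (window-window T 0 m p (m ∸ p) (≤-reflexive (m+[n∸m]≡n (s≤s⁻¹ p<1+m))))))))

    cut-right : ∀ p → p ≤ k →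
                sumN (suc k ∸ p) (λ q → cut p (p + q)) ≈ φ (window T 0 p) * conv ψ χ (window T p (k ∸ p))
    cut-right p p≤k = begin
        sumN (suc k ∸ p) (λ q → cut p (p + q))
      ≡⟨ cong (λ N → sumN N (λ q → cut p (p + q))) (+-∸-assoc 1 p≤k) ⟩
        sumN (suc (k ∸ p)) (λ q → cut p (p + q))
      ≈⟨ sumN-cong (suc (k ∸ p)) (λ q q<1+k∸p → regroup q (s≤s⁻¹ q<1+k∸p)) ⟩
        sumN (suc (k ∸ p)) (λ q → φ (window T 0 p) * (ψ (window W 0 q) * χ (window W q (k ∸ p ∸ q))))
      ≈⟨ ≈-sym (sumN-*ˡ (suc (k ∸ p)) _ _) ⟩
        φ (window T 0 p) * conv ψ χ W
      ∎
      where
      W : IRel (k ∸ p)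
      W = window T p (k ∸ p)

      regroup : ∀ q → q ≤ k ∸ p →
                cut p (p + q) ≈ φ (window T 0 p) * (ψ (window W 0 q) * χ (window W q (k ∸ p ∸ q)))
      regroup q q≤k∸p = ≈-trans (*-assoc _ _ _) (*-congˡ (*-cong middle last))
        where
        middle : ψ (window T p (p + q ∸ p)) ≈ ψ (window W 0 q)
        middle = ≈-trans
          (reflexive (cong₂ (λ a l → ψ (window T a l)) (sym (ℕₚ.+-identityʳ p)) (m+n∸m≡n p q)))
          (≈-sym (ψ-ext _ _ (window-window T p (k ∸ p) 0 q q≤k∸p)))
        last : χ (window T (p + q) (k ∸ (p + q))) ≈ χ (window W q (k ∸ p ∸ q))
        last = ≈-trans
          (reflexive (cong (λ l → χ (window T (p + q) l)) (sym (∸-+-assoc k p q))))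
          (≈-sym (χ-ext _ _ (window-window T p (k ∸ p) q (k ∸ p ∸ q) (≤-reflexive (m+[n∸m]≡n q≤k∸p)))))

module Main {c ℓ} (𝕂 : Field c ℓ) where
  open Field 𝕂
    renaming (_+_ to _+ᴿ_; refl to ≈-refl; sym to ≈-sym; trans to ≈-trans)
  open IRelAlgebra 𝕂
  open FiniteSums commutativeRing
  open Indicators commutativeRing
  open Convolution commutativeRing
  open import Relation.Binary.Reasoning.Setoid setoid

  δ : ∀ {k} → IRel k → Coefs
  δ {k} R A = coefTerm A ((k , R) , 1#)

  coefTerm-scale : ∀ {k n} (A : IRel n) (R : IRel k) b → coefTerm A ((k , R) , b) ≈ b * δ R A
  coefTerm-scale {k} {n} A R b with k ≟ℕ n
  ... | no _ = ≈-sym (zeroʳ b)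
  ... | yes refl with R ≟R A
  ...   | yes _ = ≈-sym (*-identityʳ b)
  ...   | no  _ = ≈-sym (zeroʳ b)

  δ-concentrated : ∀ {k} (R : IRel k) → Concentrated k (δ R)
  δ-concentrated {k} R n A n≢k with k ≟ℕ n
  ... | no _    = ≈-refl
  ... | yes k≡n = ⊥-elim (n≢k (sym k≡n))

  δ-same : ∀ {k} (R A : IRel k) → δ R A ≈ ind (R ≟R A)
  δ-same {k} R A with k ≟ℕ k
  ... | no k≢k = ⊥-elim (k≢k refl)
  ... | yes refl with R ≟R A
  ...   | yes _ = ≈-refl
  ...   | no  _ = ≈-refl

  δ-ext : ∀ {k} (R : IRel k) → Extensional (δ R)
  δ-ext {k} R {n} A B A≐B with k ≟ℕ n
  ... | no _ = ≈-refl
  ... | yes refl with R ≟R A | R ≟R B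
  ...   | yes _   | yes _   = ≈-refl
  ...   | no  _   | no  _   = ≈-refl
  ...   | yes R≐A | no  R≭B = ⊥-elim (R≭B (λ i j → trans (R≐A i j) (A≐B i j)))
  ...   | no  R≭A | yes R≐B = ⊥-elim (R≭A (λ i j → trans (R≐B i j) (sym (A≐B i j))))

  coef-F : ∀ {k n} (R : IRel k) (A : IRel n) → coef (F R) A ≈ δ R A
  coef-F R A = +-identityʳ _

  coef-++ : ∀ (x y : KIRel) {n} (A : IRel n) → coef (x ⊕ y) A ≈ coef x A +ᴿ coef y A
  coef-++ x y A = sumL-++ x y (coefTerm A)

  coef-· : ∀ a (x : KIRel) {n} (A : IRel n) → coef (a · x) A ≈ a * coef x A
  coef-· a []                  A = ≈-sym (zeroʳ a)
  coef-· a (((k , R) , b) ∷ x) A = begin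
      coefTerm A ((k , R) , a * b) +ᴿ coef (a · x) A
    ≈⟨ +-cong (coefTerm-scale A R (a * b)) (coef-· a x A) ⟩
      (a * b) * δ R A +ᴿ a * coef x A
    ≈⟨ +-congʳ (≈-trans (*-assoc a b _) (*-congˡ (≈-sym (coefTerm-scale A R b)))) ⟩
      a * coefTerm A ((k , R) , b) +ᴿ a * coef x A
    ≈⟨ ≈-sym (distribˡ a _ _) ⟩
      a * coef (((k , R) , b) ∷ x) A
    ∎

  coef-sumF : ∀ {k n} (L : List (IRel k)) (A : IRel n) → coef (sumF L) A ≈ sumL L (λ U → δ U A)
  coef-sumF L A = ≈-trans (sumL-concatMap F L (coefTerm A)) (sumL-cong L (λ U → coef-F U A))

  coef-ext : ∀ (x : KIRel) → Extensional (coef x)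
  coef-ext x A B A≐B = sumL-cong x term-ext
    where
    term-ext : ∀ t → coefTerm A t ≈ coefTerm B t
    term-ext ((k , R) , b) = ≈-trans (coefTerm-scale A R b)
      (≈-trans (*-congˡ (δ-ext R A B A≐B)) (≈-sym (coefTerm-scale B R b)))

  one-concentrated : Concentrated 0 (coef one)
  one-concentrated n A n≢0 = ≈-trans (coef-F IRel∅ A) (δ-concentrated IRel∅ n A n≢0)

  one-empty : ∀ (A : IRel 0) → coef one A ≈ 1#
  one-empty A = ≈-trans (coef-F IRel∅ A) (≈-trans (δ-same IRel∅ A) (ind-yes (IRel∅ ≟R A) (λ ())))

  -- Coefficients of Σ_{T ∈ Sh(R,S)} F_T.  For T of size m + n, the pair (I , D)
  -- producing T is unique: it must be the pair of off-diagonal blocks of T.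
  module _ {m n} (R : IRel m) (S : IRel n) where

    δ-glued : ∀ (T : IRel (m + n)) I D →
              δ (glued R S I D) T
                ≈ (ind (R ≟R window T 0 m) * ind (S ≟R window T m n))
                  * (ind (all? (λ a → all? (λ b → I a b ≟ᵇ upperBlock T a b)))
                     * ind (all? (λ b → all? (λ a → D b a ≟ᵇ lowerBlock T b a))))
    δ-glued T I D = begin
        δ (glued R S I D) T
      ≈⟨ δ-same (glued R S I D) T ⟩
        ind (glued R S I D ≟R T)
      ≈⟨ ind-iff (glued R S I D ≟R T) (diagonal? ×-dec (upper? ×-dec lower?))
                 (glued⇒blocks R S I D T) (blocks⇒glued R S I D T) ⟩
        ind (diagonal? ×-dec (upper? ×-dec lower?))
      ≈⟨ ≈-trans (ind-× diagonal? (upper? ×-dec lower?))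
                 (*-cong (ind-× (R ≟R window T 0 m) (S ≟R window T m n)) (ind-× upper? lower?)) ⟩
        (ind (R ≟R window T 0 m) * ind (S ≟R window T m n)) * (ind upper? * ind lower?)
      ∎
      where
      diagonal? : Dec (R ≐ window T 0 m × S ≐ window T m n)
      diagonal? = (R ≟R window T 0 m) ×-dec (S ≟R window T m n)
      upper? : Dec (∀ a b → I a b ≡ upperBlock T a b)
      upper? = all? (λ a → all? (λ b → I a b ≟ᵇ upperBlock T a b))
      lower? : Dec (∀ b a → D b a ≡ lowerBlock T b a)
      lower? = all? (λ b → all? (λ a → D b a ≟ᵇ lowerBlock T b a))

    coef-Sh-blocks : ∀ (T : IRel (m + n)) →
                     coef (sumF (Sh R S)) T ≈ δ R (window T 0 m) * δ S (window T m n)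
    coef-Sh-blocks T = begin
        coef (sumF (Sh R S)) T
      ≈⟨ coef-sumF (Sh R S) T ⟩
        sumL (Sh R S) (λ U → δ U T)
      ≈⟨ ≈-trans (sumL-concatMap _ (allRels m n) _)
                 (sumL-cong (allRels m n) (λ I → sumL-map _ (allRels n m) _)) ⟩
        sumL (allRels m n) (λ I → sumL (allRels n m) (λ D → δ (glued R S I D) T))
      ≈⟨ sumL-cong (allRels m n) (λ I → sumL-cong (allRels n m) (λ D → δ-glued T I D)) ⟩
        sumL (allRels m n) (λ I → sumL (allRels n m) (λ D → diagonal * (upper I * lower D)))
      ≈⟨ ≈-sym (≈-trans (sumL-*ˡ (allRels m n) diagonal _)
                        (sumL-cong (allRels m n) (λ I → sumL-*ˡ (allRels n m) diagonal _))) ⟩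
        diagonal * sumL (allRels m n) (λ I → sumL (allRels n m) (λ D → upper I * lower D))
      ≈⟨ *-congˡ (sumL-factorise (allRels m n) (allRels n m) upper lower) ⟩
        diagonal * (sumL (allRels m n) upper * sumL (allRels n m) lower)
      ≈⟨ *-congˡ (*-cong (count-allRels m n (upperBlock T)) (count-allRels n m (lowerBlock T))) ⟩
        diagonal * (1# * 1#)
      ≈⟨ ≈-trans (*-congˡ (*-identityˡ 1#)) (*-identityʳ diagonal) ⟩
        diagonal
      ≈⟨ ≈-sym (*-cong (δ-same R (window T 0 m)) (δ-same S (window T m n))) ⟩
        δ R (window T 0 m) * δ S (window T m n)
      ∎
      where
      diagonal : Carrier
      diagonal = ind (R ≟R window T 0 m) * ind (S ≟R window T m n)
      upper : (Fin m → Fin n → Bool) → Carrier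
      upper I = ind (all? (λ a → all? (λ b → I a b ≟ᵇ upperBlock T a b)))
      lower : (Fin n → Fin m → Bool) → Carrier
      lower D = ind (all? (λ b → all? (λ a → D b a ≟ᵇ lowerBlock T b a)))

    coef-Sh : ∀ {k} (T : IRel k) → coef (sumF (Sh R S)) T ≈ conv (δ R) (δ S) T
    coef-Sh {k} T with m + n ≟ℕ k
    ... | yes refl = begin
        coef (sumF (Sh R S)) T
      ≈⟨ coef-Sh-blocks T ⟩
        δ R (window T 0 m) * δ S (window T m n)
      ≡⟨ cong (λ l → δ R (window T 0 m) * δ S (window T m l)) (sym (m+n∸m≡n m n)) ⟩
        δ R (window T 0 m) * δ S (window T m (m + n ∸ m))
      ≈⟨ ≈-sym (conv-concentratedˡ T (δ R) (δ S) (δ-concentrated R) (m≤m+n m n)) ⟩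
        conv (δ R) (δ S) T
      ∎
    ... | no m+n≢k = ≈-trans
      (≈-trans (coef-sumF (Sh R S) T)
               (sumL-0 (Sh R S) _ (λ U → δ-concentrated U k T (λ k≡m+n → m+n≢k (sym k≡m+n)))))
      (≈-sym (conv-concentrated (δ R) (δ S) (δ-concentrated R) (δ-concentrated S) k T
                                (λ k≡m+n → m+n≢k (sym k≡m+n))))

  termCoefs : Term → Coefs
  termCoefs t A = coefTerm A t

  coef-mulTerm : ∀ {k} (T : IRel k) t u → coef (mulTerm t u) T ≈ conv (termCoefs t) (termCoefs u) T
  coef-mulTerm T ((m , R) , a) ((n , S) , b) = begin
      coef ((a * b) · sumF (Sh R S)) T
    ≈⟨ coef-· (a * b) (sumF (Sh R S)) T ⟩
      (a * b) * coef (sumF (Sh R S)) T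
    ≈⟨ ≈-trans (*-congˡ (coef-Sh R S T)) (*-assoc a b _) ⟩
      a * (b * conv (δ R) (δ S) T)
    ≈⟨ ≈-sym (≈-trans (conv-*ˡ T a (δ R) (λ A → b * δ S A)) (*-congˡ (conv-*ʳ T b (δ R) (δ S)))) ⟩
      conv (λ A → a * δ R A) (λ A → b * δ S A) T
    ≈⟨ conv-cong T (λ A → ≈-sym (coefTerm-scale A R a)) (λ A → ≈-sym (coefTerm-scale A S b)) ⟩
      conv (termCoefs ((m , R) , a)) (termCoefs ((n , S) , b)) T
    ∎

  coef-⋆ : ∀ (x y : KIRel) {k} (T : IRel k) → coef (x ⋆ y) T ≈ conv (coef x) (coef y) T
  coef-⋆ x y T = begin
      coef (x ⋆ y) T
    ≈⟨ sumL-concatMap _ x (coefTerm T) ⟩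
      sumL x (λ t → coef (concatMap (mulTerm t) y) T)
    ≈⟨ sumL-cong x (λ t → sumL-concatMap (mulTerm t) y (coefTerm T)) ⟩
      sumL x (λ t → sumL y (λ u → coef (mulTerm t u) T))
    ≈⟨ sumL-cong x (λ t → sumL-cong y (λ u → coef-mulTerm T t u)) ⟩
      sumL x (λ t → sumL y (λ u → conv (termCoefs t) (termCoefs u) T))
    ≈⟨ sumL-cong x (λ t → conv-sumLʳ T y (termCoefs t) termCoefs) ⟩
      sumL x (λ t → conv (termCoefs t) (coef y) T)
    ≈⟨ conv-sumLˡ T x termCoefs (coef y) ⟩
      conv (coef x) (coef y) T
    ∎

  -- Every axiom is now a law of convolution transported along (∗).

  ⋆-basis : ∀ {m n} (R : IRel m) (S : IRel n) → (F R ⋆ F S) ≋ sumF (Sh R S)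
  ⋆-basis R S k T = begin
      coef (F R ⋆ F S) T
    ≈⟨ coef-⋆ (F R) (F S) T ⟩
      conv (coef (F R)) (coef (F S)) T
    ≈⟨ conv-cong T (coef-F R) (coef-F S) ⟩
      conv (δ R) (δ S) T
    ≈⟨ ≈-sym (coef-Sh R S T) ⟩
      coef (sumF (Sh R S)) T
    ∎

  ⋆-cong : ∀ {x x′ y y′} → x ≋ x′ → y ≋ y′ → (x ⋆ y) ≋ (x′ ⋆ y′)
  ⋆-cong {x} {x′} {y} {y′} x≋x′ y≋y′ k T = begin
      coef (x ⋆ y) T
    ≈⟨ coef-⋆ x y T ⟩
      conv (coef x) (coef y) T
    ≈⟨ conv-cong T (x≋x′ _) (y≋y′ _) ⟩
      conv (coef x′) (coef y′) T
    ≈⟨ ≈-sym (coef-⋆ x′ y′ T) ⟩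
      coef (x′ ⋆ y′) T
    ∎

  ⋆-distribʳ : ∀ x y z → ((x ⊕ y) ⋆ z) ≋ ((x ⋆ z) ⊕ (y ⋆ z))
  ⋆-distribʳ x y z k T = begin
      coef ((x ⊕ y) ⋆ z) T
    ≈⟨ ≈-trans (coef-⋆ (x ⊕ y) z T) (conv-congˡ T (coef z) (coef-++ x y)) ⟩
      conv (λ A → coef x A +ᴿ coef y A) (coef z) T
    ≈⟨ conv-+ˡ T (coef x) (coef y) (coef z) ⟩
      conv (coef x) (coef z) T +ᴿ conv (coef y) (coef z) T
    ≈⟨ ≈-sym (≈-trans (coef-++ (x ⋆ z) (y ⋆ z) T) (+-cong (coef-⋆ x z T) (coef-⋆ y z T))) ⟩
      coef ((x ⋆ z) ⊕ (y ⋆ z)) T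
    ∎

  ⋆-distribˡ : ∀ x y z → (x ⋆ (y ⊕ z)) ≋ ((x ⋆ y) ⊕ (x ⋆ z))
  ⋆-distribˡ x y z k T = begin
      coef (x ⋆ (y ⊕ z)) T
    ≈⟨ ≈-trans (coef-⋆ x (y ⊕ z) T) (conv-congʳ T (coef x) (coef-++ y z)) ⟩
      conv (coef x) (λ A → coef y A +ᴿ coef z A) T
    ≈⟨ conv-+ʳ T (coef x) (coef y) (coef z) ⟩
      conv (coef x) (coef y) T +ᴿ conv (coef x) (coef z) T
    ≈⟨ ≈-sym (≈-trans (coef-++ (x ⋆ y) (x ⋆ z) T) (+-cong (coef-⋆ x y T) (coef-⋆ x z T))) ⟩
      coef ((x ⋆ y) ⊕ (x ⋆ z)) T
    ∎

  ⋆-scalarˡ : ∀ a x y → ((a · x) ⋆ y) ≋ (a · (x ⋆ y))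
  ⋆-scalarˡ a x y k T = begin
      coef ((a · x) ⋆ y) T
    ≈⟨ ≈-trans (coef-⋆ (a · x) y T) (conv-congˡ T (coef y) (coef-· a x)) ⟩
      conv (λ A → a * coef x A) (coef y) T
    ≈⟨ conv-*ˡ T a (coef x) (coef y) ⟩
      a * conv (coef x) (coef y) T
    ≈⟨ ≈-sym (≈-trans (coef-· a (x ⋆ y) T) (*-congˡ (coef-⋆ x y T))) ⟩
      coef (a · (x ⋆ y)) T
    ∎

  ⋆-scalarʳ : ∀ a x y → (x ⋆ (a · y)) ≋ (a · (x ⋆ y))
  ⋆-scalarʳ a x y k T = begin
      coef (x ⋆ (a · y)) T
    ≈⟨ ≈-trans (coef-⋆ x (a · y) T) (conv-congʳ T (coef x) (coef-· a y)) ⟩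
      conv (coef x) (λ A → a * coef y A) T
    ≈⟨ conv-*ʳ T a (coef x) (coef y) ⟩
      a * conv (coef x) (coef y) T
    ≈⟨ ≈-sym (≈-trans (coef-· a (x ⋆ y) T) (*-congˡ (coef-⋆ x y T))) ⟩
      coef (a · (x ⋆ y)) T
    ∎

  ⋆-assoc : ∀ x y z → ((x ⋆ y) ⋆ z) ≋ (x ⋆ (y ⋆ z))
  ⋆-assoc x y z k T = begin
      coef ((x ⋆ y) ⋆ z) T
    ≈⟨ ≈-trans (coef-⋆ (x ⋆ y) z T) (conv-congˡ T (coef z) (coef-⋆ x y)) ⟩
      conv (conv (coef x) (coef y)) (coef z) T
    ≈⟨ conv-assoc (coef x) (coef y) (coef z) (coef-ext x) (coef-ext y) (coef-ext z) T ⟩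
      conv (coef x) (conv (coef y) (coef z)) T
    ≈⟨ ≈-sym (≈-trans (coef-⋆ x (y ⋆ z) T) (conv-congʳ T (coef x) (coef-⋆ y z))) ⟩
      coef (x ⋆ (y ⋆ z)) T
    ∎

  ⋆-identityˡ : ∀ x → (one ⋆ x) ≋ x
  ⋆-identityˡ x k T = ≈-trans (coef-⋆ one x T)
    (conv-identityˡ (coef one) one-concentrated one-empty (coef x) (coef-ext x) T)

  ⋆-identityʳ : ∀ x → (x ⋆ one) ≋ x
  ⋆-identityʳ x k T = ≈-trans (coef-⋆ x one T)
    (conv-identityʳ (coef one) one-concentrated one-empty (coef x) (coef-ext x) T)

  ⋆-graded : ∀ m n x y → Homogeneous m x → Homogeneous n y → Homogeneous (m + n) (x ⋆ y)
  ⋆-graded m n x y x-hom y-hom k T k≢m+n = ≈-trans (coef-⋆ x y T)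
    (conv-concentrated (coef x) (coef y) x-hom y-hom k T k≢m+n)

mainTheorem2 : ∀ {c ℓ : Level} (𝕂 : Field c ℓ) → IRelAlgebra.IsAssocGradedAlgebra 𝕂
mainTheorem2 𝕂 = record
  { ⋆-basis         = ⋆-basis
  ; ⋆-cong          = λ {x} {x′} {y} {y′} → ⋆-cong {x} {x′} {y} {y′}
  ; ⋆-distribʳ      = ⋆-distribʳ
  ; ⋆-distribˡ      = ⋆-distribˡ
  ; ⋆-scalarˡ       = ⋆-scalarˡ
  ; ⋆-scalarʳ       = ⋆-scalarʳ
  ; ⋆-assoc         = ⋆-assoc
  ; ⋆-identityˡ     = ⋆-identityˡ
  ; ⋆-identityʳ     = ⋆-identityʳ
  ; one-homogeneous = one-concentrated
  ; ⋆-graded        = ⋆-graded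
  }
  where open Main 𝕂
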